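{- Let $k$ be a positive integer and let $P$ be a finite homogeneous and symmetric poset of height $n+1$. For every $I, J \subseteq \{0,\dots,n\}$ such that $I$ is the rank set of some chain of $P$, \[ c_k'(I, J) = c_k'(n - I, n - J), \] where $n - S = \{n - s : s \in S\}$.
   Context: Let $(P,\preceq)$ be a finite poset. A chain is a set of pairwise comparable elements; a $k$-chain is a chain with $k$ elements; the height is the maximum number of elements of a chain. $P$ is homogeneous if for any two maximal chains $L, L'$ there is an automorphism of $P$ mapping $L$ onto $L'$; symmetric if $(P,\preceq)\cong(P,\succeq)$. The rank $r(x)$ is the length of the longest chain of elements strictly below $x$, and $r(S)=\{r(x):x\in S\}$. For a chain $L$ and $J \subseteq \mathbb{N}$, $c_k'(L,J)$ is the number of $k$-chains $M$ with $L \subseteq M$ and $r(M\setminus L)\subseteq J$; for homogeneous $P$ this depends only on $r(L)$, and $c_k'(I,J)$ denotes $c_k'(L,J)$ for any chain $L$ with $r(L)=I$. -}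

module Defs where

open import Data.Nat using (ℕ; zero; suc; _≤_; _⊔_; _≡ᵇ_)
open import Data.Bool using (Bool; true; false; _∧_; _∨_; not; T; T?)
open import Data.Fin using (Fin; toℕ; opposite)
open import Data.Fin.Properties using () renaming (_≟_ to _≟F_)
open import Data.Fin.Subset using (Subset; _∈_; _⊆_; ∣_∣)
open import Data.Fin.Permutation using (Permutation′; _⟨$⟩ʳ_)
open import Data.Vec using (Vec; []; _∷_; tabulate; lookup)
open import Data.List using (List; []; _∷_; map; _++_; filterᵇ; length; foldr; allFin)
open import Data.Bool.ListAction using (all; any)
open import Data.Product using (Σ; _×_)
open import Function.Bundles using (_⇔_)
open import Relation.Binary.PropositionalEquality using (_≡_)
open import Relation.Binary.Structures using (IsDecPartialOrder)
open import Relation.Nullary.Decidable using (⌊_⌋)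

-- A finite poset, presented (up to isomorphism) on the carrier Fin m
-- with a decidable partial order.
record FinPoset : Set₁ where
  field
    m : ℕ
    _≼_ : Fin m → Fin m → Set
    isDecPartialOrder : IsDecPartialOrder _≡_ _≼_
  open IsDecPartialOrder isDecPartialOrder public using (_≤?_)

subsets : ∀ n → List (Subset n)
subsets zero = [] ∷ []
subsets (suc n) = map (true ∷_) (subsets n) ++ map (false ∷_) (subsets n)

maxList : List ℕ → ℕ
maxList = foldr _⊔_ 0

memℕ : ∀ {n} → Subset n → ℕ → Bool
memℕ [] _ = false
memℕ (b ∷ _) zero = b
memℕ (_ ∷ J) (suc r) = memℕ J r

-- n - S = { n - s : s ∈ S } for S ⊆ {0,…,n}  (opposite i has value n - i)
reflectSet : ∀ {n} → Subset (suc n) → Subset (suc n)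
reflectSet S = tabulate (λ i → lookup S (opposite i))

module _ (P : FinPoset) where
  open FinPoset P

  le : Fin m → Fin m → Bool
  le x y = ⌊ x ≤? y ⌋

  lt : Fin m → Fin m → Bool
  lt x y = le x y ∧ not ⌊ x ≟F y ⌋

  allB : (Fin m → Bool) → Bool
  allB p = all p (allFin m)

  anyB : (Fin m → Bool) → Bool
  anyB p = any p (allFin m)

  mem : Subset m → Fin m → Bool
  mem S x = lookup S x

  isChain? : Subset m → Bool
  isChain? S = allB (λ x → allB (λ y → not (mem S x ∧ mem S y) ∨ (le x y ∨ le y x)))

  IsChain : Subset m → Set
  IsChain S = T (isChain? S)

  HasHeight : ℕ → Set
  HasHeight h = Σ (Subset m) (λ S → IsChain S × ∣ S ∣ ≡ h) × (∀ S → IsChain S → ∣ S ∣ ≤ h)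

  rank : Fin m → ℕ
  rank x = maxList (map ∣_∣ (filterᵇ (λ S → isChain? S ∧ allB (λ y → not (mem S y) ∨ lt y x)) (subsets m)))

  IsMaximalChain : Subset m → Set
  IsMaximalChain S = IsChain S × (∀ S' → IsChain S' → S ⊆ S' → S' ⊆ S)

  IsAutomorphism : Permutation′ m → Set
  IsAutomorphism π = ∀ x y → (x ≼ y) ⇔ ((π ⟨$⟩ʳ x) ≼ (π ⟨$⟩ʳ y))

  Homogeneous : Set
  Homogeneous = ∀ L L' → IsMaximalChain L → IsMaximalChain L' →
    Σ (Permutation′ m) (λ π → IsAutomorphism π × (∀ x → (x ∈ L) ⇔ ((π ⟨$⟩ʳ x) ∈ L')))

  Symmetric : Set
  Symmetric = Σ (Permutation′ m) (λ π → ∀ x y → (x ≼ y) ⇔ ((π ⟨$⟩ʳ y) ≼ (π ⟨$⟩ʳ x)))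

  rankSet : (n : ℕ) → Subset m → Subset (suc n)
  rankSet n L = tabulate (λ i → anyB (λ x → mem L x ∧ (rank x ≡ᵇ toℕ i)))

  c' : ∀ {n} → ℕ → Subset m → Subset (suc n) → ℕ
  c' k L J = length (filterᵇ (λ M →
      isChain? M ∧ ((∣ M ∣ ≡ᵇ k) ∧ (allB (λ x → not (mem L x) ∨ mem M x)
        ∧ allB (λ x → not (mem M x ∧ not (mem L x)) ∨ memℕ J (rank x)))))
    (subsets m))

-- A maximal chain of P has n + 1 elements, since homogeneity maps it onto a
-- longest chain.  For an anti-automorphism φ, a longest chain below x, the
-- element x and the φ-preimage of a longest chain below φ x together form a
-- maximal chain, so rank x + rank (φ x) = n; hence φ maps a chain with rank set
-- I onto one with rank set n - I.  If L' is any chain with rank set n - I,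
-- extend φ(L) and L' to maximal chains and follow φ by an automorphism σ
-- carrying the first onto the second: ψ = σ ∘ φ is an anti-automorphism, and
-- ψ(L), L' lie in one chain and have the same rank set, so ψ(L) = L' because
-- ranks are injective on a chain.  Finally ψ maps the k-chains M ⊇ L with
-- r(M ∖ L) ⊆ J bijectively onto the k-chains M ⊇ L' with r(M ∖ L') ⊆ n - J.
module Submission where

open import Defs
open import Data.Bool using (Bool; true; false; T; T?; not; _∧_; _∨_)
open import Data.Bool.Properties using (T-∧; T-∨)
open import Data.Empty using (⊥-elim)
open import Data.Fin using (Fin; zero; suc; toℕ; fromℕ<; opposite)
open import Data.Fin.Permutation using (Permutation′; _⟨$⟩ʳ_; _⟨$⟩ˡ_; inverseˡ; inverseʳ; flip; _∘ₚ_)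
open import Data.Fin.Properties using (toℕ-fromℕ<; opposite-prop; opposite-involutive; toℕ≤pred[n]) renaming (_≟_ to _≟F_)
open import Data.Fin.Subset using (Subset; _∈_; _∉_; _⊆_; _∪_; ∣_∣; ⁅_⁆) renaming (⊥ to ∅)
open import Data.Fin.Subset.Properties
  using (_∈?_; _⊆?_; ⊆-trans; ⊆-reflexive; ⊆-antisym; p⊂q⇒∣p∣<∣q∣; x∈p∪q⁻; p⊆p∪q; q⊆p∪q; ∣⁅x⁆∣≡1; x∈⁅x⁆; x∈⁅y⁆⇒x≡y; ∉⊥)
open import Data.List using (List; []; _∷_; map; filterᵇ; length; allFin)
import Data.List as List
open import Data.List.Properties using (map-tabulate)
open import Data.List.Membership.Propositional using (lose) renaming (_∈_ to _∈ₗ_)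
open import Data.List.Membership.Propositional.Properties using (∈-map⁺; ∈-map⁻; ∈-++⁺ˡ; ∈-++⁺ʳ; ∈-filter⁺; ∈-filter⁻; ∈-allFin)
open import Data.List.Membership.Propositional.Properties.WithK using (unique∧set⇒bag)
import Data.List.Relation.Unary.All as All
open import Data.List.Relation.Unary.All.Properties using (all⁺; all⁻)
import Data.List.Relation.Unary.AllPairs as AllPairs
import Data.List.Relation.Unary.Any as Any
open import Data.List.Relation.Unary.Any.Properties using (any⁺; any⁻)
open import Data.List.Relation.Unary.Unique.Propositional using (Unique)
import Data.List.Relation.Unary.Unique.Propositional.Properties as Unique
open import Data.List.Relation.Binary.BagAndSetEquality using (∼bag⇒↭)
open import Data.List.Relation.Binary.Permutation.Propositional using (_↭_)
open import Data.List.Relation.Binary.Permutation.Propositional.Properties using (filter-↭; ↭-length)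
open import Data.Nat using (ℕ; suc; _+_; _∸_; _≤_; _<_; s≤s; _≡ᵇ_)
open import Data.Nat.Properties
  using (≤-trans; ≤-reflexive; <-irrefl; <⇒≱; n≤0⇒n≡0; m≤m⊔n; m≤n⊔m; ⊔-sel; +-suc; +-comm; suc-injective; m≤m+n; m+n∸m≡n; m∸[m∸n]≡n; ≡ᵇ⇒≡; ≡⇒≡ᵇ)
open import Data.Product using (Σ; ∃; _×_; _,_; proj₁; proj₂)
open import Data.Sum using (_⊎_; inj₁; inj₂; [_,_]; swap) renaming (map to ⊎-map)
open import Data.Unit using (tt)
open import Data.Vec using (_∷_; []; here; there; lookup; tabulate)
open import Data.Vec.Properties using (∷-injectiveʳ; lookup∘tabulate; tabulate∘lookup; tabulate-cong; []=⇒lookup; lookup⇒[]=)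
open import Function.Base using (_∘_; id)
open import Function.Bundles using (_↔_; Inverse; Injection; mk↔ₛ′; _⇔_; mk⇔; Equivalence)
open import Function.Properties.Inverse using (Inverse⇒Injection)
open import Function.Properties.Equivalence using () renaming (trans to ⇔-trans)
open import Relation.Binary.PropositionalEquality using (_≡_; _≢_; refl; cong; cong₂; sym; trans; subst; subst₂; module ≡-Reasoning)
open import Relation.Binary.Structures using (IsDecPartialOrder)
open import Relation.Nullary using (¬_; Dec; yes; no)
open import Relation.Nullary.Decidable using (toWitness; fromWitness; toWitnessFalse; fromWitnessFalse; _×-dec_)

length-filterᵇ-map : ∀ {A B : Set} {p : A → Bool} {q : B → Bool} (f : A → B) → (∀ a → q (f a) ≡ p a) →
  ∀ xs → length (filterᵇ q (map f xs)) ≡ length (filterᵇ p xs)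
length-filterᵇ-map f q∘f≡p [] = refl
length-filterᵇ-map {p = p} f q∘f≡p (x ∷ xs) rewrite q∘f≡p x with p x
... | true  = cong suc (length-filterᵇ-map f q∘f≡p xs)
... | false = length-filterᵇ-map f q∘f≡p xs

module _ {A : Set} (e : A ↔ A) {xs : List A} (unique : Unique xs) (complete : ∀ a → a ∈ₗ xs) where
  open Inverse e

  map-↔-↭ : map to xs ↭ xs
  map-↔-↭ = ∼bag⇒↭ (unique∧set⇒bag (Unique.map⁺ (Injection.injective (Inverse⇒Injection e)) unique) unique λ {z} →
    mk⇔ (λ _ → complete z) (λ _ → subst (_∈ₗ map to xs) (strictlyInverseˡ z) (∈-map⁺ to (complete (from z)))))

  length-filterᵇ-↔ : ∀ {p q : A → Bool} → (∀ a → q (to a) ≡ p a) → length (filterᵇ p xs) ≡ length (filterᵇ q xs)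
  length-filterᵇ-↔ {p} {q} q∘to≡p =
    trans (sym (length-filterᵇ-map to q∘to≡p xs)) (↭-length (filter-↭ (T? ∘ q) map-↔-↭))

subsets-unique : ∀ n → Unique (subsets n)
subsets-unique ℕ.zero = All.[] AllPairs.∷ AllPairs.[]
subsets-unique (suc n) =
  Unique.++⁺ (Unique.map⁺ ∷-injectiveʳ (subsets-unique n)) (Unique.map⁺ ∷-injectiveʳ (subsets-unique n)) heads-differ
  where
  heads-differ : ∀ {S} → ¬ (S ∈ₗ map (true ∷_) (subsets n) × S ∈ₗ map (false ∷_) (subsets n))
  heads-differ (S∈t , S∈f) with ∈-map⁻ (true ∷_) S∈t | ∈-map⁻ (false ∷_) S∈f
  ... | _ , _ , refl | _ , _ , ()

∈-subsets : ∀ {n} (S : Subset n) → S ∈ₗ subsets n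
∈-subsets [] = Any.here refl
∈-subsets {suc n} (true ∷ S) = ∈-++⁺ˡ (∈-map⁺ (true ∷_) (∈-subsets S))
∈-subsets {suc n} (false ∷ S) = ∈-++⁺ʳ (map (true ∷_) (subsets n)) (∈-map⁺ (false ∷_) (∈-subsets S))

≤-maxList : ∀ {k ks} → k ∈ₗ ks → k ≤ maxList ks
≤-maxList {ks = k ∷ ks} (Any.here refl)    = m≤m⊔n k (maxList ks)
≤-maxList {ks = k ∷ ks} (Any.there k∈ks) = ≤-trans (≤-maxList k∈ks) (m≤n⊔m k (maxList ks))

maxList≡0⊎∈ : ∀ ks → maxList ks ≡ 0 ⊎ maxList ks ∈ₗ ks
maxList≡0⊎∈ [] = inj₁ refl
maxList≡0⊎∈ (k ∷ ks) with ⊔-sel k (maxList ks)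
... | inj₁ ⊔≡k = inj₂ (Any.here ⊔≡k)
... | inj₂ ⊔≡max rewrite ⊔≡max with maxList≡0⊎∈ ks
...   | inj₁ max≡0  = inj₁ max≡0
...   | inj₂ max∈ks = inj₂ (Any.there max∈ks)

maxList-map-attained : ∀ {A : Set} (f : A → ℕ) {a xs} → a ∈ₗ xs → Σ A λ b → b ∈ₗ xs × f b ≡ maxList (map f xs)
maxList-map-attained f {a} {xs} a∈xs with maxList≡0⊎∈ (map f xs)
... | inj₁ max≡0 = a , a∈xs , trans (n≤0⇒n≡0 (≤-trans (≤-maxList (∈-map⁺ f a∈xs)) (≤-reflexive max≡0))) (sym max≡0)
... | inj₂ max∈ with ∈-map⁻ f max∈
...   | b , b∈xs , max≡fb = b , b∈xs , sym max≡fb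

T-not-∨ : ∀ {a b} → T (not a ∨ b) ⇔ (T a → T b)
T-not-∨ {true}  = mk⇔ (λ T[b] _ → T[b]) (λ f → f tt)
T-not-∨ {false} = mk⇔ (λ _ ()) (λ _ → tt)

T⇔T⇒≡ : ∀ {a b} → (T a → T b) → (T b → T a) → a ≡ b
T⇔T⇒≡ {true}  {true}  _ _ = refl
T⇔T⇒≡ {true}  {false} f _ = ⊥-elim (f tt)
T⇔T⇒≡ {false} {true}  _ g = ⊥-elim (g tt)
T⇔T⇒≡ {false} {false} _ _ = refl

module _ {m : ℕ} where

  ∈⇒T-lookup : ∀ {S : Subset m} {x} → x ∈ S → T (lookup S x)
  ∈⇒T-lookup x∈S rewrite []=⇒lookup x∈S = tt

  T-lookup⇒∈ : ∀ {S : Subset m} {x} → T (lookup S x) → x ∈ S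
  T-lookup⇒∈ {S} {x} T[Sx] with lookup S x in Sx≡true
  ... | true = lookup⇒[]= x S Sx≡true

  ∈-tabulate⁺ : ∀ {f : Fin m → Bool} {x} → T (f x) → x ∈ tabulate f
  ∈-tabulate⁺ {f} {x} T[fx] = T-lookup⇒∈ (subst T (sym (lookup∘tabulate f x)) T[fx])

  ∈-tabulate⁻ : ∀ {f : Fin m → Bool} {x} → x ∈ tabulate f → T (f x)
  ∈-tabulate⁻ {f} {x} x∈S = subst T (lookup∘tabulate f x) (∈⇒T-lookup x∈S)

length-filterᵇ-tabulate : ∀ {A : Set} {m} (p : A → Bool) (f : Fin m → A) →
  length (filterᵇ p (List.tabulate f)) ≡ length (filterᵇ (p ∘ f) (allFin m))
length-filterᵇ-tabulate {m = m} p f =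
  trans (cong (length ∘ filterᵇ p) (sym (map-tabulate id f))) (length-filterᵇ-map f (λ _ → refl) (allFin m))

∣tabulate∣ : ∀ {m} (p : Fin m → Bool) → ∣ tabulate p ∣ ≡ length (filterᵇ p (allFin m))
∣tabulate∣ {ℕ.zero} p = refl
∣tabulate∣ {suc m} p with p zero
... | true  = cong suc (trans (∣tabulate∣ (p ∘ suc)) (sym (length-filterᵇ-tabulate p suc)))
... | false = trans (∣tabulate∣ (p ∘ suc)) (sym (length-filterᵇ-tabulate p suc))

∣p∪q∣≡∣p∣+∣q∣ : ∀ {n} (p q : Subset n) → (∀ {x} → x ∈ p → x ∉ q) → ∣ p ∪ q ∣ ≡ ∣ p ∣ + ∣ q ∣
∣p∪q∣≡∣p∣+∣q∣ [] [] _ = refl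
∣p∪q∣≡∣p∣+∣q∣ (true ∷ p) (true ∷ q) disjoint = ⊥-elim (disjoint here here)
∣p∪q∣≡∣p∣+∣q∣ (true ∷ p) (false ∷ q) disjoint =
  cong suc (∣p∪q∣≡∣p∣+∣q∣ p q (λ x∈p x∈q → disjoint (there x∈p) (there x∈q)))
∣p∪q∣≡∣p∣+∣q∣ (false ∷ p) (true ∷ q) disjoint =
  trans (cong suc (∣p∪q∣≡∣p∣+∣q∣ p q (λ x∈p x∈q → disjoint (there x∈p) (there x∈q)))) (sym (+-suc ∣ p ∣ ∣ q ∣))
∣p∪q∣≡∣p∣+∣q∣ (false ∷ p) (false ∷ q) disjoint =
  ∣p∪q∣≡∣p∣+∣q∣ p q (λ x∈p x∈q → disjoint (there x∈p) (there x∈q))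

x∉p⇒∣p∪⁅x⁆∣≡1+∣p∣ : ∀ {n} {x : Fin n} {p : Subset n} → x ∉ p → ∣ p ∪ ⁅ x ⁆ ∣ ≡ suc ∣ p ∣
x∉p⇒∣p∪⁅x⁆∣≡1+∣p∣ {x = x} {p} x∉p =
  trans (∣p∪q∣≡∣p∣+∣q∣ p ⁅ x ⁆ (λ y∈p y∈⁅x⁆ → x∉p (subst (_∈ p) (x∈⁅y⁆⇒x≡y x y∈⁅x⁆) y∈p)))
        (trans (cong (∣ p ∣ +_) (∣⁅x⁆∣≡1 x)) (+-comm ∣ p ∣ 1))

p⊆q∧∣q∣≤∣p∣⇒q⊆p : ∀ {n} {p q : Subset n} → p ⊆ q → ∣ q ∣ ≤ ∣ p ∣ → q ⊆ p
p⊆q∧∣q∣≤∣p∣⇒q⊆p {p = p} p⊆q ∣q∣≤∣p∣ {x} x∈q with x ∈? p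
... | yes x∈p = x∈p
... | no  x∉p = ⊥-elim (<⇒≱ (p⊂q⇒∣p∣<∣q∣ (p⊆q , x , x∈q , x∉p)) ∣q∣≤∣p∣)

module _ {m : ℕ} (π : Permutation′ m) where

  image : Subset m → Subset m
  image S = tabulate (λ y → lookup S (π ⟨$⟩ˡ y))

  lookup-image : ∀ S x → lookup (image S) (π ⟨$⟩ʳ x) ≡ lookup S x
  lookup-image S x = trans (lookup∘tabulate _ (π ⟨$⟩ʳ x)) (cong (lookup S) (inverseˡ π))

  ∈-image⁺ : ∀ {S x} → x ∈ S → π ⟨$⟩ʳ x ∈ image S
  ∈-image⁺ {S} {x} x∈S = lookup⇒[]= (π ⟨$⟩ʳ x) (image S) (trans (lookup-image S x) ([]=⇒lookup x∈S))

  ∈-image⁻ : ∀ {S y} → y ∈ image S → π ⟨$⟩ˡ y ∈ S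
  ∈-image⁻ {S} {y} y∈πS = lookup⇒[]= (π ⟨$⟩ˡ y) S (trans (sym (lookup∘tabulate _ y)) ([]=⇒lookup y∈πS))

  image≡ : ∀ {S S′} → (∀ x → (x ∈ S) ⇔ (π ⟨$⟩ʳ x ∈ S′)) → image S ≡ S′
  image≡ {S} {S′} S≅S′ = ⊆-antisym
    (λ y∈πS → subst (_∈ S′) (inverseʳ π) (Equivalence.to (S≅S′ _) (∈-image⁻ y∈πS)))
    (λ y∈S′ → subst (_∈ image S) (inverseʳ π)
      (∈-image⁺ (Equivalence.from (S≅S′ _) (subst (_∈ S′) (sym (inverseʳ π)) y∈S′))))

  ∣image∣ : ∀ S → ∣ image S ∣ ≡ ∣ S ∣
  ∣image∣ S = begin
    ∣ image S ∣                                             ≡⟨ ∣tabulate∣ (lookup S ∘ (π ⟨$⟩ˡ_)) ⟩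
    length (filterᵇ (lookup S ∘ (π ⟨$⟩ˡ_)) (allFin m))      ≡⟨ length-filterᵇ-↔ π (Unique.allFin⁺ m) ∈-allFin
                                                                 (λ _ → cong (lookup S) (inverseˡ π)) ⟨
    length (filterᵇ (lookup S) (allFin m))                  ≡⟨ ∣tabulate∣ (lookup S) ⟨
    ∣ tabulate (lookup S) ∣                                 ≡⟨ cong ∣_∣ (tabulate∘lookup S) ⟩
    ∣ S ∣                                                   ∎
    where open ≡-Reasoning

image-↔ : ∀ {m} → Permutation′ m → Subset m ↔ Subset m
image-↔ π = mk↔ₛ′ (image π) (image (flip π)) (image-inverse (flip π)) (image-inverse π)
  where
  image-inverse : ∀ π S → image (flip π) (image π S) ≡ S
  image-inverse π S = trans (tabulate-cong (lookup-image π S)) (tabulate∘lookup S)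

module _ {n : ℕ} {S : Subset (suc n)} {i : Fin (suc n)} where

  ∈-reflectSet⁺ : opposite i ∈ S → i ∈ reflectSet S
  ∈-reflectSet⁺ = ∈-tabulate⁺ {f = lookup S ∘ opposite} ∘ ∈⇒T-lookup

  ∈-reflectSet⁻ : i ∈ reflectSet S → opposite i ∈ S
  ∈-reflectSet⁻ = T-lookup⇒∈ ∘ ∈-tabulate⁻ {f = lookup S ∘ opposite}

memℕ-toℕ : ∀ {n} (S : Subset n) (i : Fin n) → memℕ S (toℕ i) ≡ lookup S i
memℕ-toℕ (b ∷ S) zero    = refl
memℕ-toℕ (b ∷ S) (suc i) = memℕ-toℕ S i

memℕ-reflectSet : ∀ {n} (J : Subset (suc n)) {r} → r ≤ n → memℕ (reflectSet J) (n ∸ r) ≡ memℕ J r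
memℕ-reflectSet {n} J {r} r≤n = begin
  memℕ (reflectSet J) (n ∸ r)              ≡⟨ cong (memℕ (reflectSet J)) (trans (cong (n ∸_) (sym toℕ-i)) (sym (opposite-prop i))) ⟩
  memℕ (reflectSet J) (toℕ (opposite i))   ≡⟨ memℕ-toℕ (reflectSet J) (opposite i) ⟩
  lookup (reflectSet J) (opposite i)       ≡⟨ lookup∘tabulate (lookup J ∘ opposite) (opposite i) ⟩
  lookup J (opposite (opposite i))         ≡⟨ cong (lookup J) (opposite-involutive i) ⟩
  lookup J i                               ≡⟨ memℕ-toℕ J i ⟨
  memℕ J (toℕ i)                           ≡⟨ cong (memℕ J) toℕ-i ⟩
  memℕ J r                                 ∎
  where
  open ≡-Reasoning
  i : Fin (suc n)
  i = fromℕ< (s≤s r≤n)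
  toℕ-i : toℕ i ≡ r
  toℕ-i = toℕ-fromℕ< (s≤s r≤n)

module _ (P : FinPoset) where
  open FinPoset P
  open IsDecPartialOrder isDecPartialOrder using (antisym) renaming (refl to ≼-refl; trans to ≼-trans)

  T-allB⁺ : ∀ {q} → (∀ x → T (q x)) → T (allB P q)
  T-allB⁺ {q} T[q] = all⁻ q {allFin m} (All.tabulate (λ {x} _ → T[q] x))

  T-allB⁻ : ∀ {q} → T (allB P q) → ∀ x → T (q x)
  T-allB⁻ {q} T[all] x = All.lookup (all⁺ q (allFin m) T[all]) (∈-allFin x)

  T-anyB⁺ : ∀ {q} x → T (q x) → T (anyB P q)
  T-anyB⁺ {q} x T[qx] = any⁺ q (lose (∈-allFin x) T[qx])

  T-anyB⁻ : ∀ {q} → T (anyB P q) → ∃ (T ∘ q)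
  T-anyB⁻ {q} T[any] = Any.satisfied (any⁻ q (allFin m) T[any])

  allB-permute : ∀ (π : Permutation′ m) {q r} → (∀ x → q (π ⟨$⟩ʳ x) ≡ r x) → allB P q ≡ allB P r
  allB-permute π {q} {r} q∘π≡r = T⇔T⇒≡
    (λ T[q] → T-allB⁺ λ x → subst T (q∘π≡r x) (T-allB⁻ T[q] (π ⟨$⟩ʳ x)))
    (λ T[r] → T-allB⁺ λ y → subst (T ∘ q) (inverseʳ π) (subst T (sym (q∘π≡r (π ⟨$⟩ˡ y))) (T-allB⁻ T[r] (π ⟨$⟩ˡ y))))

  Comparable : Fin m → Fin m → Set
  Comparable x y = x ≼ y ⊎ y ≼ x

  infix 4 _≺_
  _≺_ : Fin m → Fin m → Set
  x ≺ y = x ≼ y × x ≢ y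

  ≺-irrefl : ∀ {x} → ¬ (x ≺ x)
  ≺-irrefl (_ , x≢x) = x≢x refl

  ≺-≼-trans : ∀ {x y z} → x ≺ y → y ≼ z → x ≺ z
  ≺-≼-trans (x≼y , x≢y) y≼z = ≼-trans x≼y y≼z , λ { refl → x≢y (antisym x≼y y≼z) }

  Chain : Subset m → Set
  Chain S = ∀ {x y} → x ∈ S → y ∈ S → Comparable x y

  StrictlyBelow : Subset m → Fin m → Set
  StrictlyBelow S x = ∀ {y} → y ∈ S → y ≺ x

  T-le⁺ : ∀ {x y} → x ≼ y → T (le P x y)
  T-le⁺ = fromWitness

  T-le⁻ : ∀ {x y} → T (le P x y) → x ≼ y
  T-le⁻ = toWitness

  chain⁺ : ∀ {S} → Chain S → IsChain P S
  chain⁺ chain = T-allB⁺ λ x → T-allB⁺ λ y → Equivalence.from T-not-∨ λ T[x∧y] →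
    let T[x] , T[y] = Equivalence.to T-∧ T[x∧y] in
    Equivalence.from T-∨ (⊎-map T-le⁺ T-le⁺ (chain (T-lookup⇒∈ T[x]) (T-lookup⇒∈ T[y])))

  chain⁻ : ∀ {S} → IsChain P S → Chain S
  chain⁻ T[chain] {x} {y} x∈S y∈S = ⊎-map T-le⁻ T-le⁻ (Equivalence.to T-∨
    (Equivalence.to T-not-∨ (T-allB⁻ (T-allB⁻ T[chain] x) y) (Equivalence.from T-∧ (∈⇒T-lookup x∈S , ∈⇒T-lookup y∈S))))

  chain-∪ : ∀ {A B} → Chain A → Chain B → (∀ {a b} → a ∈ A → b ∈ B → Comparable a b) → Chain (A ∪ B)
  chain-∪ {A} {B} A-chain B-chain across x∈A∪B y∈A∪B with x∈p∪q⁻ A B x∈A∪B | x∈p∪q⁻ A B y∈A∪B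
  ... | inj₁ x∈A | inj₁ y∈A = A-chain x∈A y∈A
  ... | inj₁ x∈A | inj₂ y∈B = across x∈A y∈B
  ... | inj₂ x∈B | inj₁ y∈A = swap (across y∈A x∈B)
  ... | inj₂ x∈B | inj₂ y∈B = B-chain x∈B y∈B

  chain-⁅⁆ : ∀ x → Chain ⁅ x ⁆
  chain-⁅⁆ x y∈⁅x⁆ z∈⁅x⁆ rewrite x∈⁅y⁆⇒x≡y x y∈⁅x⁆ | x∈⁅y⁆⇒x≡y x z∈⁅x⁆ = inj₁ ≼-refl

  ∅-chain : Chain ∅
  ∅-chain y∈∅ = ⊥-elim (∉⊥ y∈∅)

  chainBelow? : Fin m → Subset m → Bool
  chainBelow? x S = isChain? P S ∧ allB P (λ y → not (mem P S y) ∨ lt P y x)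

  chainBelow⁺ : ∀ {S x} → Chain S → StrictlyBelow S x → T (chainBelow? x S)
  chainBelow⁺ chain below = Equivalence.from T-∧ (chain⁺ chain , T-allB⁺ λ y → Equivalence.from T-not-∨ λ T[y] →
    let y≼x , y≢x = below (T-lookup⇒∈ T[y]) in Equivalence.from T-∧ (T-le⁺ y≼x , fromWitnessFalse y≢x))

  chainBelow⁻ : ∀ {S x} → T (chainBelow? x S) → Chain S × StrictlyBelow S x
  chainBelow⁻ T[S] = let T[chain] , T[below] = Equivalence.to T-∧ T[S] in chain⁻ T[chain] , λ {y} y∈S →
    let T[y≼x] , T[y≢x] = Equivalence.to T-∧ (Equivalence.to T-not-∨ (T-allB⁻ T[below] y) (∈⇒T-lookup y∈S))
    in T-le⁻ T[y≼x] , toWitnessFalse T[y≢x]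

  ∣∣≤rank : ∀ {S x} → Chain S → StrictlyBelow S x → ∣ S ∣ ≤ rank P x
  ∣∣≤rank {S} {x} chain below =
    ≤-maxList (∈-map⁺ ∣_∣ (∈-filter⁺ (T? ∘ chainBelow? x) (∈-subsets S) (chainBelow⁺ chain below)))

  chain-∪⁅⁆ : ∀ {C y} → Chain C → (∀ {z} → z ∈ C → Comparable z y) → Chain (C ∪ ⁅ y ⁆)
  chain-∪⁅⁆ {C} {y} chain comparable = chain-∪ chain (chain-⁅⁆ y) λ z∈C w∈⁅y⁆ →
    subst (Comparable _) (sym (x∈⁅y⁆⇒x≡y y w∈⁅y⁆)) (comparable z∈C)

  strictlyBelow-∪⁅⁆ : ∀ {C x y} → StrictlyBelow C x → y ≺ x → StrictlyBelow (C ∪ ⁅ y ⁆) x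
  strictlyBelow-∪⁅⁆ {C} {x} {y} below y≺x z∈C∪⁅y⁆ with x∈p∪q⁻ C ⁅ y ⁆ z∈C∪⁅y⁆
  ... | inj₁ z∈C    = below z∈C
  ... | inj₂ z∈⁅y⁆ rewrite x∈⁅y⁆⇒x≡y y z∈⁅y⁆ = y≺x

  suc∣∣≤rank : ∀ {C x y} → Chain C → StrictlyBelow C x → y ≺ x → y ∉ C →
    (∀ {z} → z ∈ C → Comparable z y) → suc ∣ C ∣ ≤ rank P x
  suc∣∣≤rank {x = x} chain below y≺x y∉C comparable =
    subst (_≤ rank P x) (x∉p⇒∣p∪⁅x⁆∣≡1+∣p∣ y∉C) (∣∣≤rank (chain-∪⁅⁆ chain comparable) (strictlyBelow-∪⁅⁆ below y≺x))

  record LongestChainBelow (x : Fin m) : Set where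
    field
      carrier : Subset m
      chain   : Chain carrier
      below   : StrictlyBelow carrier x
      size    : ∣ carrier ∣ ≡ rank P x

    saturated : ∀ {y} → y ≺ x → (∀ {z} → z ∈ carrier → Comparable z y) → y ∈ carrier
    saturated {y} y≺x comparable with y ∈? carrier
    ... | yes y∈C = y∈C
    ... | no  y∉C = ⊥-elim (<-irrefl size (suc∣∣≤rank chain below y≺x y∉C comparable))

  longestChainBelow : ∀ x → LongestChainBelow x
  longestChainBelow x
    with maxList-map-attained ∣_∣ (∈-filter⁺ (T? ∘ chainBelow? x) (∈-subsets ∅) (chainBelow⁺ ∅-chain (⊥-elim ∘ ∉⊥)))
  ... | S , S∈ , ∣S∣≡rank with ∈-filter⁻ (T? ∘ chainBelow? x) {xs = subsets m} S∈
  ...   | _ , T[S] = let chain , below = chainBelow⁻ T[S] in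
    record { carrier = S ; chain = chain ; below = below ; size = ∣S∣≡rank }

  ≺⇒rank< : ∀ {x y} → x ≺ y → rank P x < rank P y
  ≺⇒rank< {x} {y} x≺y = subst (λ r → suc r ≤ rank P y) size
    (suc∣∣≤rank chain (λ z∈C → ≺-≼-trans (below z∈C) (proj₁ x≺y)) x≺y (≺-irrefl ∘ below) (inj₁ ∘ proj₁ ∘ below))
    where open LongestChainBelow (longestChainBelow x)

  rank-injective : ∀ {S x y} → Chain S → x ∈ S → y ∈ S → rank P x ≡ rank P y → x ≡ y
  rank-injective {x = x} {y} chain x∈S y∈S rx≡ry with x ≟F y
  ... | yes x≡y = x≡y
  ... | no  x≢y with chain x∈S y∈S
  ...   | inj₁ x≼y = ⊥-elim (<-irrefl rx≡ry (≺⇒rank< (x≼y , x≢y)))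
  ...   | inj₂ y≼x = ⊥-elim (<-irrefl (sym rx≡ry) (≺⇒rank< (y≼x , x≢y ∘ sym)))

  chainContaining? : (L M : Subset m) → Dec (IsChain P M × L ⊆ M)
  chainContaining? L M = T? (isChain? P M) ×-dec L ⊆? M

  extend-to-maximal : ∀ L → IsChain P L → Σ (Subset m) λ M → IsMaximalChain P M × L ⊆ M
  extend-to-maximal L L-chain
    with maxList-map-attained ∣_∣ (∈-filter⁺ (chainContaining? L) (∈-subsets L) (L-chain , λ x∈L → x∈L))
  ... | M , M∈ , ∣M∣≡max with ∈-filter⁻ (chainContaining? L) {xs = subsets m} M∈
  ...   | _ , M-chain , L⊆M = M , (M-chain , maximal) , L⊆M
    where
    maximal : ∀ S → IsChain P S → M ⊆ S → S ⊆ M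
    maximal S S-chain M⊆S = p⊆q∧∣q∣≤∣p∣⇒q⊆p M⊆S (subst (∣ S ∣ ≤_) (sym ∣M∣≡max)
      (≤-maxList (∈-map⁺ ∣_∣ (∈-filter⁺ (chainContaining? L) (∈-subsets S) (S-chain , ⊆-trans L⊆M M⊆S)))))

  PreservesComparability : Permutation′ m → Set
  PreservesComparability π = ∀ {x y} → Comparable x y ⇔ Comparable (π ⟨$⟩ʳ x) (π ⟨$⟩ʳ y)

  chain-image : ∀ π {S} → PreservesComparability π → Chain (image π S) ⇔ Chain S
  chain-image π preserves = mk⇔
    (λ chain {x} {y} x∈S y∈S → Equivalence.from (preserves {x} {y}) (chain (∈-image⁺ π x∈S) (∈-image⁺ π y∈S)))
    (λ chain {x} {y} x∈πS y∈πS → subst₂ Comparable (inverseʳ π) (inverseʳ π)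
      (Equivalence.to (preserves {π ⟨$⟩ˡ x} {π ⟨$⟩ˡ y}) (chain (∈-image⁻ π x∈πS) (∈-image⁻ π y∈πS))))

  c'-image : ∀ {n} {J J′ : Subset (suc n)} (π : Permutation′ m) → PreservesComparability π →
    (∀ x → memℕ J′ (rank P (π ⟨$⟩ʳ x)) ≡ memℕ J (rank P x)) → ∀ k L → c' P k L J ≡ c' P k (image π L) J′
  c'-image {J = J} {J′} π preserves J′∘π≡J k L = length-filterᵇ-↔ (image-↔ π) (subsets-unique m) ∈-subsets λ M →
    cong₂ _∧_ (isChain?-image M) (cong₂ _∧_ (cong (_≡ᵇ k) (∣image∣ π M))
      (cong₂ _∧_ (allB-permute π (contains-image M)) (allB-permute π (ranks-image M))))
    where
    isChain?-image : ∀ M → isChain? P (image π M) ≡ isChain? P M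
    isChain?-image M = T⇔T⇒≡ (chain⁺ ∘ Equivalence.to (chain-image π {M} preserves) ∘ chain⁻)
                             (chain⁺ ∘ Equivalence.from (chain-image π {M} preserves) ∘ chain⁻)

    contains-image : ∀ M x → not (mem P (image π L) (π ⟨$⟩ʳ x)) ∨ mem P (image π M) (π ⟨$⟩ʳ x)
                           ≡ not (mem P L x) ∨ mem P M x
    contains-image M x rewrite lookup-image π L x | lookup-image π M x = refl

    ranks-image : ∀ M x → not (mem P (image π M) (π ⟨$⟩ʳ x) ∧ not (mem P (image π L) (π ⟨$⟩ʳ x))) ∨ memℕ J′ (rank P (π ⟨$⟩ʳ x))
                        ≡ not (mem P M x ∧ not (mem P L x)) ∨ memℕ J (rank P x)
    ranks-image M x rewrite lookup-image π L x | lookup-image π M x | J′∘π≡J x = refl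

  IsAntiAutomorphism : Permutation′ m → Set
  IsAntiAutomorphism π = ∀ x y → (x ≼ y) ⇔ ((π ⟨$⟩ʳ y) ≼ (π ⟨$⟩ʳ x))

  anti∘auto : ∀ φ σ → IsAntiAutomorphism φ → IsAutomorphism P σ → IsAntiAutomorphism (φ ∘ₚ σ)
  anti∘auto φ σ anti auto x y = ⇔-trans (anti x y) (auto (φ ⟨$⟩ʳ y) (φ ⟨$⟩ʳ x))

  module _ (φ : Permutation′ m) (anti : IsAntiAutomorphism φ) where

    anti⇒preservesComparability : PreservesComparability φ
    anti⇒preservesComparability {x} {y} = mk⇔
      [ inj₂ ∘ Equivalence.to (anti x y) , inj₁ ∘ Equivalence.to (anti y x) ]
      [ inj₂ ∘ Equivalence.from (anti y x) , inj₁ ∘ Equivalence.from (anti x y) ]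

    anti-≺⁺ : ∀ {x y} → x ≺ y → φ ⟨$⟩ʳ y ≺ φ ⟨$⟩ʳ x
    anti-≺⁺ {x} {y} (x≼y , x≢y) = Equivalence.to (anti x y) x≼y ,
      λ φy≡φx → x≢y (sym (trans (sym (inverseˡ φ)) (trans (cong (φ ⟨$⟩ˡ_) φy≡φx) (inverseˡ φ))))

    anti-≺⁻ : ∀ {x y} → φ ⟨$⟩ʳ y ≺ φ ⟨$⟩ʳ x → x ≺ y
    anti-≺⁻ {x} {y} (φy≼φx , φy≢φx) = Equivalence.from (anti x y) φy≼φx , λ { refl → φy≢φx refl }

    module MaximalChainThrough (x : Fin m) where
      private
        module C  = LongestChainBelow (longestChainBelow x)
        module C′ = LongestChainBelow (longestChainBelow (φ ⟨$⟩ʳ x))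

      lower upper through : Subset m
      lower   = C.carrier ∪ ⁅ x ⁆
      upper   = image (flip φ) C′.carrier
      through = lower ∪ upper

      ≼-lower : ∀ {y} → y ∈ lower → y ≼ x
      ≼-lower {y} y∈lower with x∈p∪q⁻ C.carrier ⁅ x ⁆ y∈lower
      ... | inj₁ y∈C = proj₁ (C.below y∈C)
      ... | inj₂ y∈⁅x⁆ rewrite x∈⁅y⁆⇒x≡y x y∈⁅x⁆ = ≼-refl

      φ-upper : ∀ {y} → y ∈ upper → φ ⟨$⟩ʳ y ∈ C′.carrier
      φ-upper = ∈-image⁻ (flip φ) {C′.carrier}

      ∈-upper⁺ : ∀ {y} → φ ⟨$⟩ʳ y ∈ C′.carrier → y ∈ upper
      ∈-upper⁺ φy∈C′ = subst (_∈ upper) (inverseˡ φ) (∈-image⁺ (flip φ) φy∈C′)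

      ≺-upper : ∀ {y} → y ∈ upper → x ≺ y
      ≺-upper = anti-≺⁻ ∘ C′.below ∘ φ-upper

      through-chain : Chain through
      through-chain = chain-∪ (chain-∪⁅⁆ C.chain (inj₁ ∘ proj₁ ∘ C.below)) upper-chain λ y∈lower z∈upper →
        inj₁ (≼-trans (≼-lower y∈lower) (proj₁ (≺-upper z∈upper)))
        where
        upper-chain : Chain upper
        upper-chain {y} {z} y∈upper z∈upper =
          Equivalence.from (anti⇒preservesComparability {y} {z}) (C′.chain (φ-upper y∈upper) (φ-upper z∈upper))

      ∣through∣ : ∣ through ∣ ≡ suc (rank P x + rank P (φ ⟨$⟩ʳ x))
      ∣through∣ = begin
        ∣ lower ∪ upper ∣                   ≡⟨ ∣p∪q∣≡∣p∣+∣q∣ lower upper (λ y∈lower y∈upper →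
                                                 ≺-irrefl (≺-≼-trans (≺-upper y∈upper) (≼-lower y∈lower))) ⟩
        ∣ lower ∣ + ∣ upper ∣               ≡⟨ cong₂ _+_ (x∉p⇒∣p∪⁅x⁆∣≡1+∣p∣ (≺-irrefl ∘ C.below)) (∣image∣ (flip φ) C′.carrier) ⟩
        suc ∣ C.carrier ∣ + ∣ C′.carrier ∣  ≡⟨ cong₂ (λ a b → suc a + b) C.size C′.size ⟩
        suc (rank P x + rank P (φ ⟨$⟩ʳ x))  ∎
        where open ≡-Reasoning

      C⊆through : C.carrier ⊆ through
      C⊆through = p⊆p∪q upper ∘ p⊆p∪q ⁅ x ⁆

      upper⊆through : upper ⊆ through
      upper⊆through = q⊆p∪q lower upper

      x∈through : x ∈ through
      x∈through = p⊆p∪q upper (q⊆p∪q C.carrier ⁅ x ⁆ (x∈⁅x⁆ x))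

      -- Every y comparable with all of `through' is x, or is absorbed by the
      -- longest chain below x, or is sent by φ into the longest chain below φ x.
      ⊆through : ∀ {S} → Chain S → through ⊆ S → S ⊆ through
      ⊆through {S} S-chain through⊆S {y} y∈S with x ≟F y | S-chain y∈S (through⊆S x∈through)
      ... | yes refl | _ = x∈through
      ... | no x≢y | inj₁ y≼x =
            C⊆through (C.saturated (y≼x , x≢y ∘ sym) λ z∈C → S-chain (through⊆S (C⊆through z∈C)) y∈S)
      ... | no x≢y | inj₂ x≼y = upper⊆through (∈-upper⁺ (C′.saturated (anti-≺⁺ (x≼y , x≢y)) comparable))
        where
        comparable : ∀ {z} → z ∈ C′.carrier → Comparable z (φ ⟨$⟩ʳ y)
        comparable z∈C′ = subst (λ w → Comparable w (φ ⟨$⟩ʳ y)) (inverseʳ φ) (Equivalence.to anti⇒preservesComparability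
          (S-chain (through⊆S (upper⊆through (∈-image⁺ (flip φ) z∈C′))) y∈S))

      through-maximal : IsMaximalChain P through
      through-maximal = chain⁺ through-chain , λ S S-chain through⊆S → ⊆through (chain⁻ S-chain) through⊆S

  ∈-rankSet⁺ : ∀ {n} L {x} (i : Fin (suc n)) → x ∈ L → rank P x ≡ toℕ i → i ∈ rankSet P n L
  ∈-rankSet⁺ L {x} i x∈L rx≡i = ∈-tabulate⁺ {f = λ j → anyB P (λ y → mem P L y ∧ (rank P y ≡ᵇ toℕ j))}
    (T-anyB⁺ {q = λ y → mem P L y ∧ (rank P y ≡ᵇ toℕ i)} x (Equivalence.from T-∧ (∈⇒T-lookup x∈L , ≡⇒≡ᵇ _ _ rx≡i)))

  ∈-rankSet⁻ : ∀ {n} L {i : Fin (suc n)} → i ∈ rankSet P n L → ∃ λ x → x ∈ L × rank P x ≡ toℕ i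
  ∈-rankSet⁻ L i∈rankSet
    with T-anyB⁻ (∈-tabulate⁻ {f = λ j → anyB P (λ y → mem P L y ∧ (rank P y ≡ᵇ toℕ j))} i∈rankSet)
  ... | x , T[x] = let T[x∈L] , T[rx≡i] = Equivalence.to T-∧ T[x] in x , T-lookup⇒∈ T[x∈L] , ≡ᵇ⇒≡ _ _ T[rx≡i]

  module _ {n} (rank≤n : ∀ x → rank P x ≤ n) where

    rankSet-image : ∀ π → (∀ x → rank P (π ⟨$⟩ʳ x) ≡ n ∸ rank P x) →
      ∀ L → rankSet P n (image π L) ≡ reflectSet (rankSet P n L)
    rankSet-image π rank∘π L = ⊆-antisym
      (λ {i} i∈ → let y , y∈πL , ry≡i = ∈-rankSet⁻ (image π L) i∈ in
        ∈-reflectSet⁺ (∈-rankSet⁺ L (opposite i) (∈-image⁻ π {L} y∈πL)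
          (trans (rank∘π⁻¹ y) (trans (cong (n ∸_) ry≡i) (sym (opposite-prop i))))))
      (λ {i} i∈ → let x , x∈L , rx≡i = ∈-rankSet⁻ L (∈-reflectSet⁻ i∈) in
        ∈-rankSet⁺ (image π L) i (∈-image⁺ π x∈L)
          (trans (rank∘π x) (trans (cong (n ∸_) (trans rx≡i (opposite-prop i))) (m∸[m∸n]≡n (toℕ≤pred[n] i)))))
      where
      rank∘π⁻¹ : ∀ y → rank P (π ⟨$⟩ˡ y) ≡ n ∸ rank P y
      rank∘π⁻¹ y = begin
        rank P (π ⟨$⟩ˡ y)                ≡⟨ m∸[m∸n]≡n (rank≤n (π ⟨$⟩ˡ y)) ⟨
        n ∸ (n ∸ rank P (π ⟨$⟩ˡ y))      ≡⟨ cong (n ∸_) (rank∘π (π ⟨$⟩ˡ y)) ⟨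
        n ∸ rank P (π ⟨$⟩ʳ (π ⟨$⟩ˡ y))   ≡⟨ cong (λ z → n ∸ rank P z) (inverseʳ π) ⟩
        n ∸ rank P y                     ∎
        where open ≡-Reasoning

    rankSet-injective : ∀ {M A B} → Chain M → A ⊆ M → B ⊆ M → rankSet P n A ≡ rankSet P n B → A ≡ B
    rankSet-injective {M} M-chain A⊆M B⊆M rankSet-A≡B =
      ⊆-antisym (⊆-by-rankSet A⊆M B⊆M (⊆-reflexive rankSet-A≡B)) (⊆-by-rankSet B⊆M A⊆M (⊆-reflexive (sym rankSet-A≡B)))
      where
      ⊆-by-rankSet : ∀ {A B} → A ⊆ M → B ⊆ M → rankSet P n A ⊆ rankSet P n B → A ⊆ B
      ⊆-by-rankSet {A} {B} A⊆M B⊆M rankSet-A⊆B {x} x∈A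
        with ∈-rankSet⁻ B (rankSet-A⊆B (∈-rankSet⁺ A (fromℕ< (s≤s (rank≤n x))) x∈A (sym (toℕ-fromℕ< (s≤s (rank≤n x))))))
      ... | y , y∈B , ry≡rx =
        subst (_∈ B) (rank-injective M-chain (B⊆M y∈B) (A⊆M x∈A) (trans ry≡rx (toℕ-fromℕ< (s≤s (rank≤n x))))) y∈B

  module HomogeneousOfHeight {n} (homogeneous : Homogeneous P) (height : HasHeight P (suc n)) where
    private
      H : Subset m
      H = proj₁ (proj₁ height)

      ∣H∣≡1+n : ∣ H ∣ ≡ suc n
      ∣H∣≡1+n = proj₂ (proj₂ (proj₁ height))

      H-maximal : IsMaximalChain P H
      H-maximal = proj₁ (proj₂ (proj₁ height)) , λ S S-chain H⊆S →
        p⊆q∧∣q∣≤∣p∣⇒q⊆p H⊆S (subst (∣ S ∣ ≤_) (sym ∣H∣≡1+n) (proj₂ height S S-chain))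

    ∣maximal∣ : ∀ {N} → IsMaximalChain P N → ∣ N ∣ ≡ suc n
    ∣maximal∣ {N} N-maximal with homogeneous N H N-maximal H-maximal
    ... | σ , _ , N≅H = trans (sym (∣image∣ σ N)) (trans (cong ∣_∣ (image≡ σ N≅H)) ∣H∣≡1+n)

    module AntiAutomorphism (φ : Permutation′ m) (anti : IsAntiAutomorphism φ) where

      rank+rank∘anti : ∀ x → rank P x + rank P (φ ⟨$⟩ʳ x) ≡ n
      rank+rank∘anti x = suc-injective (trans (sym ∣through∣) (∣maximal∣ through-maximal))
        where open MaximalChainThrough φ anti x

      rank≤n : ∀ x → rank P x ≤ n
      rank≤n x = subst (rank P x ≤_) (rank+rank∘anti x) (m≤m+n (rank P x) (rank P (φ ⟨$⟩ʳ x)))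

      rank∘anti : ∀ x → rank P (φ ⟨$⟩ʳ x) ≡ n ∸ rank P x
      rank∘anti x = trans (sym (m+n∸m≡n (rank P x) _)) (cong (_∸ rank P x) (rank+rank∘anti x))

      reflect-chain : ∀ L → IsChain P L → IsChain P (image φ L) × rankSet P n (image φ L) ≡ reflectSet (rankSet P n L)
      reflect-chain L L-chain = chain⁺ (Equivalence.from (chain-image φ {L} (anti⇒preservesComparability φ anti)) (chain⁻ L-chain))
                                , rankSet-image rank≤n φ rank∘anti L

      c'-anti : ∀ k L (J : Subset (suc n)) → c' P k L J ≡ c' P k (image φ L) (reflectSet J)
      c'-anti k L J = c'-image {J = J} {reflectSet J} φ (anti⇒preservesComparability φ anti)
        (λ x → trans (cong (memℕ (reflectSet J)) (rank∘anti x)) (memℕ-reflectSet J (rank≤n x))) k L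

    open AntiAutomorphism public

    anti-automorphism-onto : ∀ φ → IsAntiAutomorphism φ → ∀ L L′ → IsChain P L → IsChain P L′ →
      rankSet P n L′ ≡ reflectSet (rankSet P n L) → Σ (Permutation′ m) λ π → IsAntiAutomorphism π × image π L ≡ L′
    anti-automorphism-onto φ anti L L′ L-chain L′-chain rankSet-L′
      with extend-to-maximal (image φ L) (proj₁ (reflect-chain φ anti L L-chain)) | extend-to-maximal L′ L′-chain
    ... | M₁ , M₁-maximal , φL⊆M₁ | M₂ , M₂-maximal , L′⊆M₂ with homogeneous M₁ M₂ M₁-maximal M₂-maximal
    ... | σ , σ-auto , M₁≅M₂ = φ ∘ₚ σ , π-anti ,
          rankSet-injective (rank≤n φ anti) (chain⁻ {M₂} (proj₁ M₂-maximal)) πL⊆M₂ L′⊆M₂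
            (trans (proj₂ (reflect-chain (φ ∘ₚ σ) π-anti L L-chain)) (sym rankSet-L′))
      where
      π-anti : IsAntiAutomorphism (φ ∘ₚ σ)
      π-anti = anti∘auto φ σ anti σ-auto

      πL⊆M₂ : image (φ ∘ₚ σ) L ⊆ M₂
      πL⊆M₂ y∈πL = subst (_∈ M₂) (inverseʳ (φ ∘ₚ σ))
        (Equivalence.to (M₁≅M₂ _) (φL⊆M₁ (∈-image⁺ φ (∈-image⁻ (φ ∘ₚ σ) {L} y∈πL))))

fact5p1 : (k : ℕ) → 1 ≤ k → (P : FinPoset) → (n : ℕ) →
    Homogeneous P → Symmetric P → HasHeight P (suc n) →
    (I J : Subset (suc n)) → (L : Subset (FinPoset.m P)) →
    IsChain P L → rankSet P n L ≡ I →
    Σ (Subset (FinPoset.m P)) (λ L' → IsChain P L' × rankSet P n L' ≡ reflectSet I)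
    × (∀ L' → IsChain P L' → rankSet P n L' ≡ reflectSet I →
         c' P k L J ≡ c' P k L' (reflectSet J))
-- The argument works for every k.
fact5p1 k _ P n homogeneous (φ , φ-anti) height .(rankSet P n L) J L L-chain refl =
  (image φ L , reflect-chain φ φ-anti L L-chain) , λ L′ L′-chain rankSet-L′ →
    let π , π-anti , πL≡L′ = anti-automorphism-onto φ φ-anti L L′ L-chain L′-chain rankSet-L′
    in trans (c'-anti π π-anti k L J) (cong (λ L″ → c' P k L″ (reflectSet J)) πL≡L′)
  where open HomogeneousOfHeight P homogeneous height
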